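{- Let $d \geq 2$, let $T_n$ be a complete rooted $d$-ary tree of height $n$, and for each $i \in \{0,\dots,n\}$ let $T_i$ be the subtree of height $i$ with the same root. Fix a subgroup $H \subset \mathrm{Aut}(T_n)$, and for each $i \leq n$ let $C_i \subset \mathrm{Aut}(T_i)$ be the centralizer of $H|_{T_i} = \{g|_{T_i} : g \in H\}$ in $\mathrm{Aut}(T_i)$. Consider the restriction map $C_n \to C_i$. Then there is an injective group homomorphism $$h : \ker(C_n \to C_i) \to \mathrm{Aut}(T_{n-i})^{m(i)},$$ where $m(i)$ is the number of orbits of the action of $H$ on the vertices of level $i$. Moreover, $h$ is an isomorphism if the action of $H$ on the vertices of level $i$ is free.
   Context: An action of a group $H$ on a set $X$ is free if $gx = x$ for some $x \in X$ implies $g = 1$. -}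

module Defs where

open import Level using (Level; _⊔_) renaming (zero to lzero)
open import Data.Nat using (ℕ; zero; suc; _≤_; _∸_; s≤s)
open import Data.Nat.Properties using (≤-trans; n≤1+n; ≤-refl)
open import Data.Fin using (Fin)
open import Data.Vec using (Vec; []; _∷_; tail)
open import Data.Product using (Σ; ∃; _×_; _,_; proj₁)
open import Relation.Binary.PropositionalEquality
  using (_≡_; refl; sym; trans; cong)

-- A vertex of level k is a word  w : Vec (Fin d) k ; the root is [],
-- and the children of w are the words  x ∷ w  (x : Fin d); the parent
-- of  x ∷ w  is  w = tail (x ∷ w).  T_n consists of the levels k ≤ n.
--
-- An automorphism of the rooted tree T_n is a family of bijections of
-- the levels k ≤ n commuting with the parent map.  (The functions are
-- given on all levels for convenience; values at levels > n are junk
-- and are ignored by the equality _≈_.)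

Word : ℕ → ℕ → Set
Word d k = Vec (Fin d) k

record Aut (d n : ℕ) : Set where
  field
    act     : ∀ k → Word d k → Word d k
    inv     : ∀ k → Word d k → Word d k
    inv-act : ∀ k → k ≤ n → ∀ w → inv k (act k w) ≡ w
    act-inv : ∀ k → k ≤ n → ∀ w → act k (inv k w) ≡ w
    parent  : ∀ k → suc k ≤ n → ∀ x w → tail (act (suc k) (x ∷ w)) ≡ act k w
open Aut public

_≈_ : ∀ {d n} → Aut d n → Aut d n → Set
_≈_ {d} {n} g h = ∀ k → k ≤ n → ∀ (w : Word d k) → act g k w ≡ act h k w

private
  parent′ : ∀ {d n} (g : Aut d n) k → suc k ≤ n → ∀ (v : Word d (suc k)) →
            tail (act g (suc k) v) ≡ act g k (tail v)
  parent′ g k p (x ∷ w) = parent g k p x w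

  ≤-pred′ : ∀ {k n} → suc k ≤ n → k ≤ n
  ≤-pred′ {k} p = ≤-trans (n≤1+n k) p

idA : ∀ {d n} → Aut d n
idA = record
  { act = λ k w → w ; inv = λ k w → w
  ; inv-act = λ _ _ _ → refl ; act-inv = λ _ _ _ → refl
  ; parent = λ _ _ _ _ → refl }

_∘A_ : ∀ {d n} → Aut d n → Aut d n → Aut d n
_∘A_ {d} {n} g h = record
  { act = λ k w → act g k (act h k w)
  ; inv = λ k w → inv h k (inv g k w)
  ; inv-act = λ k p w → trans (cong (inv h k) (inv-act g k p (act h k w))) (inv-act h k p w)
  ; act-inv = λ k p w → trans (cong (act g k) (act-inv h k p (inv g k w))) (act-inv g k p w)
  ; parent = λ k p x w →
      trans (parent′ g k p (act h (suc k) (x ∷ w)))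
            (cong (act g k) (parent h k p x w)) }

invA : ∀ {d n} → Aut d n → Aut d n
invA {d} {n} g = record
  { act = inv g ; inv = act g
  ; inv-act = act-inv g ; act-inv = inv-act g
  ; parent = λ k p x w → lemma k p x w }
  where
  lemma : ∀ k → suc k ≤ n → ∀ x (w : Word d k) → tail (inv g (suc k) (x ∷ w)) ≡ inv g k w
  lemma k p x w with inv g (suc k) (x ∷ w) in eq
  ... | y ∷ u =
    sym (trans (cong (inv g k) step) (inv-act g k (≤-pred′ p) u))
    where
    step : w ≡ act g k u
    step = trans (cong tail (trans (sym (act-inv g (suc k) p (x ∷ w)))
                                   (cong (act g (suc k)) eq)))
                 (parent g k p y u)

restrict : ∀ {d n i} → i ≤ n → Aut d n → Aut d i
restrict i≤n g = record
  { act = act g ; inv = inv g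
  ; inv-act = λ k p → inv-act g k (≤-trans p i≤n)
  ; act-inv = λ k p → act-inv g k (≤-trans p i≤n)
  ; parent = λ k p → parent g k (≤-trans p i≤n) }

record IsSubgroup {ℓ} {d n} (H : Aut d n → Set ℓ) : Set ℓ where
  field
    resp : ∀ {g h} → g ≈ h → H g → H h
    id∈  : H idA
    ∘∈   : ∀ {g h} → H g → H h → H (g ∘A h)
    inv∈ : ∀ {g} → H g → H (invA g)

Restricted : ∀ {ℓ} {d n i} → i ≤ n → (Aut d n → Set ℓ) → Aut d i → Set ℓ
Restricted i≤n H g′ = Σ _ λ g → H g × (g′ ≈ restrict i≤n g)

Centralizer : ∀ {ℓ} {d k} → (Aut d k → Set ℓ) → Aut d k → Set ℓ
Centralizer S c = ∀ g → S g → (c ∘A g) ≈ (g ∘A c)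

C : ∀ {ℓ} {d n} (H : Aut d n → Set ℓ) {i} → i ≤ n → Aut d i → Set ℓ
C H i≤n = Centralizer (Restricted i≤n H)

Ker : ∀ {ℓ} {d n i} (H : Aut d n → Set ℓ) → i ≤ n → Set ℓ
Ker {n = n} H i≤n = Σ _ λ c → C H (≤-refl {n}) c × (restrict i≤n c ≈ idA)

SameOrbit : ∀ {ℓ} {d n} (H : Aut d n → Set ℓ) i → Word d i → Word d i → Set ℓ
SameOrbit H i v w = Σ _ λ g → H g × (act g i v ≡ w)

-- m is the number of H-orbits on level i: there is a system of
-- representatives r : Fin m → level i, meeting every orbit exactly once
NumOrbits : ∀ {ℓ} {d n} (H : Aut d n → Set ℓ) i → ℕ → Set ℓ
NumOrbits {d = d} H i m =
  Σ (Fin m → Word d i) λ r →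
    (∀ v → Σ (Fin m) λ j → SameOrbit H i (r j) v) ×
    (∀ j j′ → SameOrbit H i (r j) (r j′) → j ≡ j′)

FreeOn : ∀ {ℓ} {d n} (H : Aut d n → Set ℓ) i → Set ℓ
FreeOn {d = d} H i = ∀ g → H g → ∀ (v : Word d i) → act g i v ≡ v → g ≈ idA

Pow : ℕ → ℕ → ℕ → Set
Pow d k m = Fin m → Aut d k

_≈ᵖ_ : ∀ {d k m} → Pow d k m → Pow d k m → Set
a ≈ᵖ b = ∀ j → a j ≈ b j

_∘ᵖ_ : ∀ {d k m} → Pow d k m → Pow d k m → Pow d k m
(a ∘ᵖ b) j = a j ∘A b j

IsHom : ∀ {ℓ} {d n i k m} {H : Aut d n → Set ℓ} {i≤n : i ≤ n} →
        (Ker H i≤n → Pow d k m) → Set ℓ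
IsHom h =
  (∀ x y → proj₁ x ≈ proj₁ y → h x ≈ᵖ h y) ×
  (∀ x y z → proj₁ z ≈ (proj₁ x ∘A proj₁ y) → h z ≈ᵖ (h x ∘ᵖ h y))

IsInjective : ∀ {ℓ} {d n i k m} {H : Aut d n → Set ℓ} {i≤n : i ≤ n} →
              (Ker H i≤n → Pow d k m) → Set ℓ
IsInjective h = ∀ x y → h x ≈ᵖ h y → proj₁ x ≈ proj₁ y

IsSurjective : ∀ {ℓ} {d n i k m} {H : Aut d n → Set ℓ} {i≤n : i ≤ n} →
               (Ker H i≤n → Pow d k m) → Set ℓ
IsSurjective {H = H} {i≤n = i≤n} h = ∀ a → Σ (Ker H i≤n) λ x → h x ≈ᵖ a

{-# OPTIONS --safe #-}
module Submission where

open import Defs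
open import Data.Nat using (ℕ; zero; suc; _≤_; _<_; _+_; _∸_; s≤s)
open import Data.Nat.Properties
  using (≤-refl; ≤-trans; <⇒≤; <⇒≱; ≮⇒≥; 1+n≰n; m≤n+m; _<?_; <-irrelevant;
         ≡-irrelevant; +-cancelʳ-≡; m∸n+n≡m; m+n≤o⇒m≤o∸n; m≤o∸n⇒m+n≤o)
open import Data.Fin using (Fin)
open import Data.Vec using (Vec; []; _∷_; tail; _++_; take; drop)
open import Data.Vec.Properties using (take++drop≡id; ++-injectiveˡ; ++-injectiveʳ)
open import Data.Product using (Σ; _×_; _,_; proj₁; proj₂)
open import Data.Empty using (⊥-elim)
open import Function using (_∘_)
open import Relation.Nullary using (yes; no)
open import Relation.Binary.PropositionalEquality
open ≡-Reasoning

-- A vertex of level l + i is a word u ++ v with v its ancestor at level i, and every g acts by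
-- g (u ++ v) = g|_v (u) ++ g (v), its section g|_v being an automorphism of T_{n-i}.  An element c
-- of the kernel fixes level i, and for v = t (r j) with t ∈ H and r j the representative of the
-- orbit of v, commuting with t gives c|_v = t|_{r j} ∘ c|_{r j} ∘ (t|_{r j})⁻¹.  Hence c is
-- determined by its sections at the m representatives, which gives the injective homomorphism
-- c ↦ (c|_{r j})_j.  If H acts freely on level i, the t above is unique, so conversely any
-- (a_j)_j is realised by the automorphism acting below each t (r j) as t ∘ a_j ∘ t⁻¹; uniqueness
-- of t is exactly what makes it commute with H.

module _ {A : Set} where

  take-++ : ∀ {l i} (u : Vec A l) (v : Vec A i) → take l (u ++ v) ≡ u
  take-++ {l} u v = ++-injectiveˡ (take l (u ++ v)) u (take++drop≡id l (u ++ v))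

  drop-++ : ∀ {l i} (u : Vec A l) (v : Vec A i) → drop l (u ++ v) ≡ v
  drop-++ {l} u v = ++-injectiveʳ (take l (u ++ v)) u (take++drop≡id l (u ++ v))

  tail-++ : ∀ {l i} (u : Vec A (suc l)) (v : Vec A i) → tail (u ++ v) ≡ tail u ++ v
  tail-++ (x ∷ u) v = refl

  tail-take : ∀ l {i} (xs : Vec A (suc l + i)) → tail (take (suc l) xs) ≡ take l (tail xs)
  tail-take l (x ∷ xs) = refl

  drop-suc : ∀ l {i} (xs : Vec A (suc l + i)) → drop (suc l) xs ≡ drop l (tail xs)
  drop-suc l (x ∷ xs) = refl

  ++-identityˡ-0 : ∀ {i} (u : Vec A 0) (v : Vec A i) → u ++ v ≡ v
  ++-identityˡ-0 [] v = refl

module _ {d n : ℕ} (g : Aut d n) where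

  inv-≡ : ∀ {k} → k ≤ n → {x y : Word d k} → act g k x ≡ y → inv g k y ≡ x
  inv-≡ {k} p {x} gx≡y = trans (cong (inv g k) (sym gx≡y)) (inv-act g k p x)

  act-drop : ∀ l {i} → l + i ≤ n → (w : Word d (l + i)) →
             drop l (act g (l + i) w) ≡ act g i (drop l w)
  act-drop zero        p w       = refl
  act-drop (suc l) {i} p (x ∷ w) = begin
    drop (suc l) (act g (suc l + i) (x ∷ w)) ≡⟨ drop-suc l (act g (suc l + i) (x ∷ w)) ⟩
    drop l (tail (act g (suc l + i) (x ∷ w))) ≡⟨ cong (drop l) (parent g (l + i) p x w) ⟩
    drop l (act g (l + i) w)                  ≡⟨ act-drop l (<⇒≤ p) w ⟩
    act g i (drop l w)                        ∎

  act-++ : ∀ l {i} → l + i ≤ n → (u : Word d l) (v : Word d i) →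
           act g (l + i) (u ++ v) ≡ take l (act g (l + i) (u ++ v)) ++ act g i v
  act-++ l p u v = begin
    act g _ (u ++ v)                          ≡⟨ take++drop≡id l (act g _ (u ++ v)) ⟨
    take l (act g _ (u ++ v)) ++ drop l (act g _ (u ++ v))
      ≡⟨ cong (take l (act g _ (u ++ v)) ++_) (act-drop l p (u ++ v)) ⟩
    take l (act g _ (u ++ v)) ++ act g _ (drop l (u ++ v))
      ≡⟨ cong (λ z → take l (act g _ (u ++ v)) ++ act g _ z) (drop-++ u v) ⟩
    take l (act g _ (u ++ v)) ++ act g _ v    ∎

conj : ∀ {d n} → Aut d n → Aut d n → Aut d n
conj g α = g ∘A (α ∘A invA g)

conj-∘ : ∀ {d n} (g g′ h α : Aut d n) → g′ ≈ (h ∘A g) →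
         (conj g′ α ∘A h) ≈ (h ∘A conj g α)
conj-∘ g g′ h α g′≈hg k p y = begin
  act g′ k (act α k (inv g′ k (act h k y))) ≡⟨ cong (act g′ k ∘ act α k) inv-g′-h ⟩
  act g′ k (act α k (inv g k y))            ≡⟨ g′≈hg k p _ ⟩
  act h k (act g k (act α k (inv g k y)))   ∎
  where
  inv-g′-h : inv g′ k (act h k y) ≡ inv g k y
  inv-g′-h = inv-≡ g′ p (trans (g′≈hg k p (inv g k y)) (cong (act h k) (act-inv g k p y)))

conj-id : ∀ {d n} (g α : Aut d n) → g ≈ idA → conj g α ≈ α
conj-id g α = conj-∘ idA g idA α

centralizes⇒∈C : ∀ {ℓ d n} (H : Aut d n → Set ℓ) (c : Aut d n) →
                 (∀ h → H h → (c ∘A h) ≈ (h ∘A c)) → C H ≤-refl c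
centralizes⇒∈C H c comm g (h , h∈H , g≈h) k p w = begin
  act c k (act g k w) ≡⟨ cong (act c k) (g≈h k p w) ⟩
  act c k (act h k w) ≡⟨ comm h h∈H k p w ⟩
  act h k (act c k w) ≡⟨ g≈h k p (act c k w) ⟨
  act g k (act c k w) ∎

data Split (i : ℕ) : ℕ → Set where
  above : ∀ {k} → k < i → Split i k
  below : ∀ l {k} → l + i ≡ k → Split i k

split : ∀ i k → Split i k
split i k with k <? i
... | yes k<i = above k<i
... | no  k≮i = below (k ∸ i) (m∸n+n≡m (≮⇒≥ k≮i))

split-irrelevant : ∀ {i k} (s t : Split i k) → s ≡ t
split-irrelevant     (above p)      (above q)      = cong above (<-irrelevant p q)
split-irrelevant {i} (above p)      (below l refl) = ⊥-elim (<⇒≱ p (m≤n+m i l))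
split-irrelevant {i} (below l refl) (above p)      = ⊥-elim (<⇒≱ p (m≤n+m i l))
split-irrelevant {i} (below l refl) (below l′ eq) with +-cancelʳ-≡ i l′ l eq
... | refl = cong (below l) (≡-irrelevant refl eq)

≈-via-split : ∀ {d n} i (g h : Aut d n) →
              (∀ k → k < i → ∀ w → act g k w ≡ act h k w) →
              (∀ l → l + i ≤ n → ∀ u v → act g (l + i) (u ++ v) ≡ act h (l + i) (u ++ v)) →
              g ≈ h
≈-via-split i g h agree-above agree-below k p w with split i k
... | above k<i    = agree-above k k<i w
... | below l refl =
  subst (λ w → act g _ w ≡ act h _ w) (take++drop≡id l w) (agree-below l p (take l w) (drop l w))

module _ {d n i : ℕ} (i≤n : i ≤ n) where

  private
    below-≤ : ∀ {l} → l ≤ n ∸ i → l + i ≤ n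
    below-≤ {l} = m≤o∸n⇒m+n≤o l i≤n

    ≤-below : ∀ {l} → l + i ≤ n → l ≤ n ∸ i
    ≤-below {l} = m+n≤o⇒m≤o∸n l

  -- the subtree at v is identified with T_{n-i} through u ↦ u ++ v
  section : Aut d n → Word d i → Aut d (n ∸ i)
  section g v = record
    { act     = λ l u → take l (act g (l + i) (u ++ v))
    ; inv     = λ l u → take l (inv g (l + i) (u ++ act g i v))
    ; inv-act = λ l p u → begin
        take l (inv g _ (take l (act g _ (u ++ v)) ++ act g i v))
          ≡⟨ cong (take l ∘ inv g _) (act-++ g l (below-≤ p) u v) ⟨
        take l (inv g _ (act g _ (u ++ v)))
          ≡⟨ cong (take l) (inv-act g _ (below-≤ p) (u ++ v)) ⟩
        take l (u ++ v) ≡⟨ take-++ u v ⟩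
        u ∎
    ; act-inv = λ l p u → begin
        take l (act g _ (take l (inv g _ (u ++ act g i v)) ++ v))
          ≡⟨ cong (λ z → take l (act g _ (take l (inv g _ (u ++ act g i v)) ++ z)))
                  (inv-act g i i≤n v) ⟨
        take l (act g _ (take l (inv g _ (u ++ act g i v)) ++ inv g i (act g i v)))
          ≡⟨ cong (take l ∘ act g _) (act-++ (invA g) l (below-≤ p) u (act g i v)) ⟨
        take l (act g _ (inv g _ (u ++ act g i v)))
          ≡⟨ cong (take l) (act-inv g _ (below-≤ p) (u ++ act g i v)) ⟩
        take l (u ++ act g i v) ≡⟨ take-++ u (act g i v) ⟩
        u ∎
    ; parent  = λ l p x u →
        trans (tail-take l (act g (suc l + i) (x ∷ u ++ v)))
              (cong (take l) (parent g (l + i) (below-≤ p) x (u ++ v)))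
    }

  section-cong : ∀ g h v → g ≈ h → section g v ≈ section h v
  section-cong g h v g≈h l p u = cong (take l) (g≈h _ (below-≤ p) (u ++ v))

  section-∘ : ∀ g h v → section (g ∘A h) v ≈ (section g (act h i v) ∘A section h v)
  section-∘ g h v l p u = cong (take l ∘ act g _) (act-++ h l (below-≤ p) u v)

  private
    Local : Set
    Local = Word d i → ∀ l → Word d l → Word d l

    graftAt : Local → ∀ k → Split i k → Word d k → Word d k
    graftAt f k        (above _)      w = w
    graftAt f .(l + i) (below l refl) w = f (drop l w) l (take l w) ++ drop l w

    graftAt-above : ∀ f k s → k ≤ i → ∀ w → graftAt f k s w ≡ w
    graftAt-above f k  (above _)            k≤i w = refl
    graftAt-above f .i (below zero refl)    k≤i w = ++-identityˡ-0 (f w 0 []) w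
    graftAt-above f _  (below (suc l) refl) k≤i w =
      ⊥-elim (1+n≰n (≤-trans (s≤s (m≤n+m i l)) k≤i))

    graftAt-inverse : ∀ f f′ → (∀ v l → l ≤ n ∸ i → ∀ u → f′ v l (f v l u) ≡ u) →
                      ∀ k s → k ≤ n → ∀ w → graftAt f′ k s (graftAt f k s w) ≡ w
    graftAt-inverse f f′ f′∘f k        (above _)      p w = refl
    graftAt-inverse f f′ f′∘f .(l + i) (below l refl) p w = begin
      f′ (drop l fw) l (take l fw) ++ drop l fw
        ≡⟨ cong₂ (λ u v → f′ v l u ++ v) (take-++ (f (drop l w) l (take l w)) (drop l w))
                                           (drop-++ (f (drop l w) l (take l w)) (drop l w)) ⟩
      f′ (drop l w) l (f (drop l w) l (take l w)) ++ drop l w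
        ≡⟨ cong (_++ drop l w) (f′∘f (drop l w) l (≤-below p) (take l w)) ⟩
      take l w ++ drop l w ≡⟨ take++drop≡id l w ⟩
      w ∎
      where fw = f (drop l w) l (take l w) ++ drop l w

    graftAt-parent : ∀ f →
                     (∀ v l → suc l ≤ n ∸ i → ∀ x u → tail (f v (suc l) (x ∷ u)) ≡ f v l u) →
                     ∀ k (s : Split i k) (s′ : Split i (suc k)) → suc k ≤ n → ∀ x w →
                     tail (graftAt f (suc k) s′ (x ∷ w)) ≡ graftAt f k s w
    graftAt-parent f f-parent k (above k<i) s′ p x w =
      cong tail (graftAt-above f (suc k) s′ k<i (x ∷ w))
    graftAt-parent f f-parent .(l + i) (below l refl) s′ p x w
      rewrite split-irrelevant s′ (below (suc l) refl) =
      trans (tail-++ (f (drop l w) (suc l) (x ∷ take l w)) (drop l w))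
            (cong (_++ drop l w) (f-parent (drop l w) l (≤-below p) x (take l w)))

  graft : (Word d i → Aut d (n ∸ i)) → Aut d n
  graft b = record
    { act     = λ k → graftAt (λ v → act (b v)) k (split i k)
    ; inv     = λ k → graftAt (λ v → inv (b v)) k (split i k)
    ; inv-act = λ k → graftAt-inverse _ _ (λ v → inv-act (b v)) k (split i k)
    ; act-inv = λ k → graftAt-inverse _ _ (λ v → act-inv (b v)) k (split i k)
    ; parent  = λ k → graftAt-parent _ (λ v → parent (b v)) k (split i k) (split i (suc k))
    }

  graft-above : ∀ b k → k ≤ i → ∀ w → act (graft b) k w ≡ w
  graft-above b k k≤i = graftAt-above _ k (split i k) k≤i

  graft-++ : ∀ b l (u : Word d l) (v : Word d i) → act (graft b) (l + i) (u ++ v) ≡ act (b v) l u ++ v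
  graft-++ b l u v rewrite split-irrelevant (split i (l + i)) (below l refl)
                         | take-++ u v | drop-++ u v = refl

  graft-section : ∀ (φ : Word d i → Aut d n) → (∀ v → act (φ v) i v ≡ v) →
                  ∀ l → l + i ≤ n → (u : Word d l) (v : Word d i) →
                  act (graft (λ v → section (φ v) v)) (l + i) (u ++ v) ≡ act (φ v) (l + i) (u ++ v)
  graft-section φ φ-fix l p u v = begin
    act (graft (λ v → section (φ v) v)) (l + i) (u ++ v)
      ≡⟨ graft-++ (λ v → section (φ v) v) l u v ⟩
    take l (act (φ v) _ (u ++ v)) ++ v
      ≡⟨ cong (take l (act (φ v) _ (u ++ v)) ++_) (φ-fix v) ⟨
    take l (act (φ v) _ (u ++ v)) ++ act (φ v) i v
      ≡⟨ act-++ (φ v) l p u v ⟨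
    act (φ v) _ (u ++ v) ∎

module RestrictionKernel {ℓ} {d n i m : ℕ} (i≤n : i ≤ n)
         (H : Aut d n → Set ℓ) (H-subgroup : IsSubgroup H)
         (r : Fin m → Word d i)
         (cover : ∀ v → Σ (Fin m) λ j → SameOrbit H i (r j) v)
         (unique : ∀ j j′ → SameOrbit H i (r j) (r j′) → j ≡ j′) where

  open IsSubgroup H-subgroup

  orbit : Word d i → Fin m
  orbit v = proj₁ (cover v)

  transporter : Word d i → Aut d n
  transporter v = proj₁ (proj₂ (cover v))

  transporter-∈ : ∀ v → H (transporter v)
  transporter-∈ v = proj₁ (proj₂ (proj₂ (cover v)))

  transporter-rep : ∀ v → act (transporter v) i (r (orbit v)) ≡ v
  transporter-rep v = proj₂ (proj₂ (proj₂ (cover v)))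

  orbit-rep : ∀ j → orbit (r j) ≡ j
  orbit-rep j =
    unique (orbit (r j)) j (transporter (r j) , transporter-∈ (r j) , transporter-rep (r j))

  orbit-act : ∀ {h} → H h → ∀ v → orbit (act h i v) ≡ orbit v
  orbit-act {h} h∈H v = sym (unique (orbit v) (orbit (act h i v)) (invA t′ ∘A (h ∘A t) , e∈H , e-rep))
    where
    t = transporter v
    t′ = transporter (act h i v)

    e∈H : H (invA t′ ∘A (h ∘A t))
    e∈H = ∘∈ (inv∈ (transporter-∈ (act h i v))) (∘∈ h∈H (transporter-∈ v))

    e-rep : inv t′ i (act h i (act t i (r (orbit v)))) ≡ r (orbit (act h i v))
    e-rep = inv-≡ t′ i≤n
      (trans (transporter-rep (act h i v)) (cong (act h i) (sym (transporter-rep v))))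

  sections : Ker H i≤n → Pow d (n ∸ i) m
  sections (c , _) j = section i≤n c (r j)

  sections-hom : IsHom {H = H} {i≤n} sections
  sections-hom = (λ x y x≈y j → section-cong i≤n (proj₁ x) (proj₁ y) (r j) x≈y) , composition
    where
    composition : ∀ x y z → proj₁ z ≈ (proj₁ x ∘A proj₁ y) →
                  sections z ≈ᵖ (sections x ∘ᵖ sections y)
    composition (x , _) (y , _ , y∈K) (z , _) z≈xy j l p u = begin
      act (section i≤n z (r j)) l u                 ≡⟨ section-cong i≤n z (x ∘A y) (r j) z≈xy l p u ⟩
      act (section i≤n (x ∘A y) (r j)) l u          ≡⟨ section-∘ i≤n x y (r j) l p u ⟩
      act (section i≤n x (act y i (r j))) l y|u
        ≡⟨ cong (λ v → act (section i≤n x v) l y|u) (y∈K i ≤-refl (r j)) ⟩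
      act (section i≤n x (r j)) l y|u ∎
      where y|u = act (section i≤n y (r j)) l u

  kernel-act-++ : (x : Ker H i≤n) → ∀ l → l + i ≤ n → (u : Word d l) (v : Word d i) →
    act (proj₁ x) (l + i) (u ++ v) ≡
    act (transporter v) (l + i)
      (act (sections x (orbit v)) l (take l (inv (transporter v) (l + i) (u ++ v))) ++ r (orbit v))
  kernel-act-++ (c , c∈C , c∈K) l p u v = begin
    act c _ (u ++ v)                 ≡⟨ cong (act c _) (act-inv t _ p (u ++ v)) ⟨
    act c _ (act t _ w)              ≡⟨ c∈C t (t , transporter-∈ v , λ _ _ _ → refl) _ p w ⟩
    act t _ (act c _ w)              ≡⟨ cong (act t _ ∘ act c _) w≡u′++r ⟩
    act t _ (act c _ (u′ ++ r j))    ≡⟨ cong (act t _) (act-++ c l p u′ (r j)) ⟩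
    act t _ (take l (act c _ (u′ ++ r j)) ++ act c i (r j))
      ≡⟨ cong (λ z → act t _ (take l (act c _ (u′ ++ r j)) ++ z)) (c∈K i ≤-refl (r j)) ⟩
    act t _ (take l (act c _ (u′ ++ r j)) ++ r j) ∎
    where
    t = transporter v
    j = orbit v
    w = inv t (l + i) (u ++ v)
    u′ = take l w
    w≡u′++r : w ≡ u′ ++ r j
    w≡u′++r = trans (act-++ (invA t) l p u v) (cong (u′ ++_) (inv-≡ t i≤n (transporter-rep v)))

  sections-injective : IsInjective {H = H} {i≤n} sections
  sections-injective x@(c , _ , c∈K) y@(c′ , _ , c′∈K) same =
    ≈-via-split i c c′ agree-above agree-below
    where
    agree-above : ∀ k → k < i → ∀ w → act c k w ≡ act c′ k w
    agree-above k k<i w = trans (c∈K k (<⇒≤ k<i) w) (sym (c′∈K k (<⇒≤ k<i) w))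

    agree-below : ∀ l → l + i ≤ n → ∀ u v → act c (l + i) (u ++ v) ≡ act c′ (l + i) (u ++ v)
    agree-below l p u v = begin
      act c _ (u ++ v)                         ≡⟨ kernel-act-++ x l p u v ⟩
      act t _ (act (sections x j) l u′ ++ r j)
        ≡⟨ cong (λ z → act t _ (z ++ r j)) (same j l (m+n≤o⇒m≤o∸n l p) u′) ⟩
      act t _ (act (sections y j) l u′ ++ r j) ≡⟨ kernel-act-++ y l p u v ⟨
      act c′ _ (u ++ v)                        ∎
      where
      t = transporter v
      j = orbit v
      u′ = take l (inv t (l + i) (u ++ v))

  module _ (free : FreeOn H i) where

    free-≈ : ∀ {g g′} → H g → H g′ → ∀ {x} → act g i x ≡ act g′ i x → g ≈ g′
    free-≈ {g} {g′} g∈H g′∈H {x} gx≡g′x k p w = begin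
      act g k w                       ≡⟨ act-inv g′ k p (act g k w) ⟨
      act g′ k (inv g′ k (act g k w)) ≡⟨ cong (act g′ k) (g′⁻¹g≈id k p w) ⟩
      act g′ k w                      ∎
      where
      g′⁻¹g≈id : (invA g′ ∘A g) ≈ idA
      g′⁻¹g≈id = free (invA g′ ∘A g) (∘∈ (inv∈ g′∈H) g∈H) x (inv-≡ g′ i≤n (sym gx≡g′x))

    transporter-act : ∀ {h} → H h → ∀ v → transporter (act h i v) ≈ (h ∘A transporter v)
    transporter-act {h} h∈H v = free-≈ (transporter-∈ (act h i v)) (∘∈ h∈H (transporter-∈ v)) (begin
      act (transporter (act h i v)) i (r (orbit v))
        ≡⟨ cong (λ j → act (transporter (act h i v)) i (r j)) (orbit-act h∈H v) ⟨
      act (transporter (act h i v)) i (r (orbit (act h i v))) ≡⟨ transporter-rep (act h i v) ⟩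
      act h i v                                              ≡⟨ cong (act h i) (transporter-rep v) ⟨
      act h i (act (transporter v) i (r (orbit v)))          ∎)

    transporter-rep-id : ∀ j → transporter (r j) ≈ idA
    transporter-rep-id j = free-≈ (transporter-∈ (r j)) id∈
      (trans (cong (λ j′ → act (transporter (r j)) i (r j′)) (sym (orbit-rep j)))
             (transporter-rep (r j)))

    spread : Aut d (n ∸ i) → Aut d n
    spread α = graft i≤n (λ _ → α)

    local : Pow d (n ∸ i) m → Word d i → Aut d n
    local a v = conj (transporter v) (spread (a (orbit v)))

    local-fix : ∀ a v → act (local a v) i v ≡ v
    local-fix a v = begin
      act t i (act (spread (a (orbit v))) i (inv t i v))
        ≡⟨ cong (act t i) (graft-above i≤n (λ _ → a (orbit v)) i ≤-refl (inv t i v)) ⟩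
      act t i (inv t i v) ≡⟨ act-inv t i i≤n v ⟩
      v                   ∎
      where t = transporter v

    local-act : ∀ a {h} → H h → ∀ v → (local a (act h i v) ∘A h) ≈ (h ∘A local a v)
    local-act a {h} h∈H v k p y = begin
      act (conj t′ (spread (a (orbit (act h i v))))) k (act h k y)
        ≡⟨ cong (λ j → act (conj t′ (spread (a j))) k (act h k y)) (orbit-act h∈H v) ⟩
      act (conj t′ (spread (a (orbit v)))) k (act h k y)
        ≡⟨ conj-∘ (transporter v) t′ h (spread (a (orbit v))) (transporter-act h∈H v) k p y ⟩
      act h k (act (local a v) k y) ∎
      where t′ = transporter (act h i v)

    glue : Pow d (n ∸ i) m → Aut d n
    glue a = graft i≤n (λ v → section i≤n (local a v) v)

    glue-above : ∀ a k → k ≤ i → ∀ w → act (glue a) k w ≡ w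
    glue-above a = graft-above i≤n (λ v → section i≤n (local a v) v)

    glue-++ : ∀ a l → l + i ≤ n → ∀ u v →
              act (glue a) (l + i) (u ++ v) ≡ act (local a v) (l + i) (u ++ v)
    glue-++ a = graft-section i≤n (local a) (local-fix a)

    glue-commutes : ∀ a h → H h → (glue a ∘A h) ≈ (h ∘A glue a)
    glue-commutes a h h∈H = ≈-via-split i (glue a ∘A h) (h ∘A glue a) agree-above agree-below
      where
      c = glue a

      agree-above : ∀ k → k < i → ∀ w → act c k (act h k w) ≡ act h k (act c k w)
      agree-above k k<i w = trans (glue-above a k (<⇒≤ k<i) (act h k w))
                                  (cong (act h k) (sym (glue-above a k (<⇒≤ k<i) w)))

      agree-below : ∀ l → l + i ≤ n → ∀ u v →
                    act c (l + i) (act h (l + i) (u ++ v)) ≡ act h (l + i) (act c (l + i) (u ++ v))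
      agree-below l p u v = begin
        act c _ (act h _ (u ++ v))                     ≡⟨ cong (act c _) (act-++ h l p u v) ⟩
        act c _ (s ++ act h i v)                       ≡⟨ glue-++ a l p s (act h i v) ⟩
        act (local a (act h i v)) _ (s ++ act h i v)
          ≡⟨ cong (act (local a (act h i v)) _) (act-++ h l p u v) ⟨
        act (local a (act h i v)) _ (act h _ (u ++ v)) ≡⟨ local-act a h∈H v _ p (u ++ v) ⟩
        act h _ (act (local a v) _ (u ++ v))           ≡⟨ cong (act h _) (glue-++ a l p u v) ⟨
        act h _ (act c _ (u ++ v))                     ∎
        where s = take l (act h (l + i) (u ++ v))

    glue-section : ∀ a j → section i≤n (glue a) (r j) ≈ a j
    glue-section a j l p u = begin
      take l (act (glue a) _ (u ++ r j))         ≡⟨ cong (take l) (glue-++ a l q u (r j)) ⟩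
      take l (act (local a (r j)) _ (u ++ r j))
        ≡⟨ cong (take l) (conj-id (transporter (r j)) α (transporter-rep-id j) _ q (u ++ r j)) ⟩
      take l (act α _ (u ++ r j))                ≡⟨ cong (take l) (graft-++ i≤n (λ _ → a j′) l u (r j)) ⟩
      take l (act (a j′) l u ++ r j)             ≡⟨ take-++ (act (a j′) l u) (r j) ⟩
      act (a j′) l u                             ≡⟨ cong (λ j′ → act (a j′) l u) (orbit-rep j) ⟩
      act (a j) l u                              ∎
      where
      q = m≤o∸n⇒m+n≤o l i≤n p
      j′ = orbit (r j)
      α = spread (a j′)

    sections-surjective : IsSurjective {H = H} {i≤n} sections
    sections-surjective a =
      (glue a , centralizes⇒∈C H (glue a) (glue-commutes a) , glue-above a) , glue-section a

proposition11 : ∀ {ℓ} (d n i : ℕ) → 2 ≤ d → (i≤n : i ≤ n) →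
    (H : Aut d n → Set ℓ) → IsSubgroup H →
    (m : ℕ) → NumOrbits H i m →
    Σ (Ker H i≤n → Pow d (n ∸ i) m) λ h →
      IsHom {H = H} {i≤n} h × IsInjective {H = H} {i≤n} h ×
      (FreeOn H i → IsSurjective {H = H} {i≤n} h)
proposition11 d n i _ i≤n H H-subgroup m (r , cover , unique) =
  sections , sections-hom , sections-injective , sections-surjective
  where open RestrictionKernel i≤n H H-subgroup r cover unique
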